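{- Let $n \ge 1$ and let $\mathcal{F}$ be a family of (simple, labelled) graphs, each with vertex set $\{1, 2, \ldots, n\}$, such that for all $G, H \in \mathcal{F}$ (including $G = H$) the graph $G \cap H$ is connected. Then $|\mathcal{F}| \leq 2^{\binom{n}{2}} / 2^{n-1}$. Consequently, $\mu(\text{connected}, n) = 2^{ -n+1}$.
   Context: For graphs $G, H$ on the common vertex set $V = \{1,\ldots,n\}$, $G \cap H$ denotes the graph on $V$ with edge set $E(G) \cap E(H)$; it is connected if it is connected as a graph on all of $V$. For a graph property $\mathcal{P}$, a family $\mathcal{F}$ of graphs on $V$ is called $\mathcal{P}$-intersecting if $G \cap H$ satisfies $\mathcal{P}$ for all $G, H \in \mathcal{F}$. Define $\mu(\mathcal{P}, n) := \max\{ |\mathcal{F}| \cdot 2^{ -\binom{n}{2}} : \mathcal{F} \text{ is a } \mathcal{P}\text{ -intersecting family of graphs on } \{1,\ldots,n\}\}$, i.e. the maximum fraction of all $2^{\binom{n}{2}}$ labelled graphs on $\{1,\ldots,n\}$ that a $\mathcal{P}$-intersecting family can contain. Here $\mathcal{P}$ = "is connected". -}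

module Defs where

open import Data.Nat using (ℕ)
open import Data.Fin using (Fin)
open import Data.Bool using (Bool; true; false; _∧_)
open import Data.List using (List)
open import Data.List.Relation.Unary.All using (All)
open import Data.List.Relation.Unary.AllPairs using (AllPairs)
open import Data.Product using (Σ; ∃; _×_)
open import Relation.Binary.PropositionalEquality using (_≡_; _≢_)

Graph : ℕ → Set
Graph n = Fin n → Fin n → Bool

IsSimple : ∀ {n} → Graph n → Set
IsSimple {n} G = ((i : Fin n) → G i i ≡ false) × ((i j : Fin n) → G i j ≡ G j i)

_∩_ : ∀ {n} → Graph n → Graph n → Graph n
(G ∩ H) i j = G i j ∧ H i j

data Reach {n : ℕ} (G : Graph n) (u : Fin n) : Fin n → Set where
  here : Reach G u u
  step : ∀ {v w} → Reach G u v → G v w ≡ true → Reach G u w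

Connected : ∀ {n} → Graph n → Set
Connected {n} G = (u v : Fin n) → Reach G u v

Distinct : ∀ {n} → Graph n → Graph n → Set
Distinct {n} G H = Σ (Fin n) λ i → Σ (Fin n) λ j → G i j ≢ H i j

IsConnIntersectingFamily : ∀ {n} → List (Graph n) → Set
IsConnIntersectingFamily F =
  All IsSimple F × AllPairs Distinct F ×
  All (λ G → All (λ H → Connected (G ∩ H)) F) F

module Submission where

-- Seidel-switch a graph G at the neighbourhood of vertex 0 and
-- delete vertex 0: the result  switchOut G  on vertices 1 … m has an edge ij
-- iff  G(i,j) ⊕ G(0,i) ⊕ G(0,j).  If two simple graphs have the same
-- switchOut and a connected intersection, then their neighbourhoods of 0
-- agree at 0 and the agreement propagates along every common edge, so the
-- graphs coincide (rigidity).  Hence switchOut separates the members of the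
-- family, and a pigeonhole count over the m C 2 vertex pairs of a simple
-- graph on m vertices gives  |F| ≤ 2 ^ (m C 2) = 2 ^ (n C 2) / 2 ^ m.
--
-- Lower bound.  All simple graphs on 1 … m, each with vertex 0 joined to
-- every other vertex, form such a family: any two share that spanning star.

open import Defs
open import Data.Nat using (ℕ; _≤_; _*_; _^_; _∸_)
open import Data.Nat.Combinatorics using (_C_)
open import Data.List using (List; length)
open import Data.Product using (_×_; Σ)
open import Relation.Binary.PropositionalEquality using (_≡_)

open import Data.Nat using (zero; suc; _+_; z≤n; s≤s)
open import Data.Nat.Properties
  using (+-mono-≤; *-monoˡ-≤; *-comm; +-suc; ^-distribˡ-+-*; +-identityʳ; module ≤-Reasoning)
open import Data.Nat.Combinatorics using (nC1≡n; nCk+nC[k+1]≡[n+1]C[k+1])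
open import Data.Bool using (Bool; true; false; _xor_; _≟_)
open import Data.Bool.Properties using (not-injective; xor-comm; xor-same; ∧-conicalˡ; ∧-conicalʳ)
open import Data.Fin using (Fin; zero; suc)
open import Data.List using ([]; _∷_; map; _++_; filter; allFin; cartesianProductWith)
open import Data.List.Properties using (length-map; length-++; length-tabulate)
open import Data.List.Membership.Propositional.Properties using (∈-allFin)
open import Data.List.Relation.Unary.All as All using (All; []; _∷_)
open import Data.List.Relation.Unary.AllPairs as AllPairs using (AllPairs; []; _∷_)
import Data.List.Relation.Unary.All.Properties as AllP
import Data.List.Relation.Unary.AllPairs.Properties as AllPairsP
import Data.Product as Product
open import Data.Product using (_,_; proj₁; proj₂)
open import Data.Vec.Functional as Vector using (Vector)
open import Data.Empty using (⊥-elim)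
open import Relation.Nullary using (¬_)
open import Relation.Binary.PropositionalEquality
  using (_≢_; refl; sym; trans; cong; cong₂; module ≡-Reasoning)

xor-cancelˡ : ∀ a {x y} → a xor x ≡ a xor y → x ≡ y
xor-cancelˡ false eq = eq
xor-cancelˡ true  eq = not-injective eq

xor-cancelʳ : ∀ a {x y} → x xor a ≡ y xor a → x ≡ y
xor-cancelʳ a {x} {y} eq = xor-cancelˡ a (trans (xor-comm a x) (trans eq (xor-comm y a)))

xor-solve₃ : ∀ {a b c a′ b′ c′} → a ≡ a′ → b ≡ b′ →
             a xor (b xor c) ≡ a′ xor (b′ xor c′) → c ≡ c′
xor-solve₃ {a} {b} refl refl eq = xor-cancelˡ b (xor-cancelˡ a eq)

xor-solve₁ : ∀ {a b c a′ b′ c′} → b ≡ b′ → c ≡ c′ →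
             a xor (b xor c) ≡ a′ xor (b′ xor c′) → a ≡ a′
xor-solve₁ {b = b} {c} refl refl eq = xor-cancelʳ (b xor c) eq

All⇒AllPairs : ∀ {A : Set} {Q : A → Set} {R : A → A → Set} →
               (∀ {x y} → Q x → Q y → R x y) → ∀ {xs} → All Q xs → AllPairs R xs
All⇒AllPairs f []       = []
All⇒AllPairs f (q ∷ qs) = All.map (f q) qs ∷ All⇒AllPairs f qs

All²⇒AllPairs : ∀ {A : Set} {R : A → A → Set} {xs} →
                All (λ x → All (R x) xs) xs → AllPairs R xs
All²⇒AllPairs {xs = []}    []         = []
All²⇒AllPairs {xs = _ ∷ _} (rx ∷ rxs) = All.tail rx ∷ All²⇒AllPairs (All.map All.tail rxs)

length-split : ∀ {A : Set} (f : A → Bool) xs →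
  length xs ≡ length (filter (λ x → f x ≟ true) xs) + length (filter (λ x → f x ≟ false) xs)
length-split f []       = refl
length-split f (x ∷ xs) with f x
... | true  = cong suc (length-split f xs)
... | false = trans (cong suc (length-split f xs)) (sym (+-suc _ _))

module _ {X Y Z : Set} (f : X → Y → Z) where

  length-product : ∀ xs ys → length (cartesianProductWith f xs ys) ≡ length xs * length ys
  length-product []       ys = refl
  length-product (x ∷ xs) ys =
    trans (length-++ (map (f x) ys)) (cong₂ _+_ (length-map (f x) ys) (length-product xs ys))

  All-product : ∀ {P : Z → Set} {Q : Y → Set} → (∀ {x y} → Q y → P (f x y)) →
                ∀ xs {ys} → All Q ys → All P (cartesianProductWith f xs ys)
  All-product g []       qs = []
  All-product g (x ∷ xs) qs = AllP.++⁺ (AllP.map⁺ (All.map g qs)) (All-product g xs qs)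

  AllPairs-product : ∀ {R : X → X → Set} {S : Y → Y → Set} {T : Z → Z → Set} →
    (∀ {x x′ y y′} → R x x′ → T (f x y) (f x′ y′)) →
    (∀ {x y y′} → S y y′ → T (f x y) (f x y′)) →
    ∀ {xs ys} → AllPairs R xs → AllPairs S ys → AllPairs T (cartesianProductWith f xs ys)
  AllPairs-product sepˡ sepʳ {[]} [] sy = []
  AllPairs-product {R = R} {T = T} sepˡ sepʳ {x ∷ xs} {ys} (rx ∷ rxs) sy =
    AllPairsP.++⁺ (AllPairsP.map⁺ (AllPairs.map sepʳ sy))
                  (AllPairs-product sepˡ sepʳ rxs sy)
                  (AllP.map⁺ (All.universal (λ y → laterRows y rx) ys))
    where
    laterRows : ∀ y {xs′} → All (R x) xs′ → All (T (f x y)) (cartesianProductWith f xs′ ys)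
    laterRows y []       = []
    laterRows y (r ∷ rs) = AllP.++⁺ (AllP.map⁺ (All.universal (λ _ → sepˡ r) ys)) (laterRows y rs)

AgreeOn : ∀ {A P : Set} → (A → P → Bool) → List P → A → A → Set
AgreeOn ev ps x y = All (λ p → ev x p ≡ ev y p) ps

-- Pigeonhole: if any two members of L are told apart by some Boolean test
-- in ps, then L has at most 2 ^ |ps| members.  Split L by the first test.
separated-bound : ∀ {A P : Set} (ev : A → P → Bool) ps (L : List A) →
  AllPairs (λ x y → ¬ AgreeOn ev ps x y) L → length L ≤ 2 ^ length ps
separated-bound ev []       []          _                 = z≤n
separated-bound ev []       (_ ∷ [])    _                 = s≤s z≤n
separated-bound ev []       (_ ∷ _ ∷ _) ((sep ∷ _) ∷ _)   = ⊥-elim (sep [])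
separated-bound {A} ev (p ∷ ps) L sep = begin
  length L                                  ≡⟨ length-split (λ x → ev x p) L ⟩
  length (half true) + length (half false)  ≤⟨ +-mono-≤ (halfBound true) (halfBound false) ⟩
  2 ^ length ps + 2 ^ length ps             ≡⟨ cong (2 ^ length ps +_) (sym (+-identityʳ _)) ⟩
  2 ^ length (p ∷ ps)                       ∎
  where
  open ≤-Reasoning
  half : Bool → List A
  half b = filter (λ x → ev x p ≟ b) L
  -- members of one half agree on p, so they must be told apart by ps
  halfBound : ∀ b → length (half b) ≤ 2 ^ length ps
  halfBound b = separated-bound ev ps (half b)
    (AllPairs.zipWith (λ (notAgree , sameAtP) agree → notAgree (sameAtP ∷ agree))
      ( AllPairsP.filter⁺ _ sep
      , All⇒AllPairs (λ ex ey → trans ex (sym ey)) (AllP.all-filter _ L)))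

sucC2 : ∀ k → suc k C 2 ≡ k + k C 2
sucC2 k = trans (sym (nCk+nC[k+1]≡[n+1]C[k+1] k 1)) (cong (_+ k C 2) (nC1≡n k))

pow-C2-step : ∀ m → 2 ^ (m C 2) * 2 ^ m ≡ 2 ^ (suc m C 2)
pow-C2-step m = begin
  2 ^ (m C 2) * 2 ^ m  ≡⟨ *-comm (2 ^ (m C 2)) (2 ^ m) ⟩
  2 ^ m * 2 ^ (m C 2)  ≡⟨ ^-distribˡ-+-* 2 m (m C 2) ⟨
  2 ^ (m + m C 2)      ≡⟨ cong (2 ^_) (sucC2 m) ⟨
  2 ^ (suc m C 2)      ∎
  where open ≡-Reasoning

-- The vertex pairs i < j of Fin m, as positions at which a graph is read.
pairs : (m : ℕ) → List (Fin m × Fin m)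
pairs zero    = []
pairs (suc k) = map (λ j → zero , suc j) (allFin k) ++ map (Product.map suc suc) (pairs k)

length-pairs : ∀ m → length (pairs m) ≡ m C 2
length-pairs zero    = refl
length-pairs (suc k) = begin
  length (pairs (suc k))
    ≡⟨ length-++ (map (λ j → zero , suc j) (allFin k)) ⟩
  length (map (λ j → zero {k} , suc j) (allFin k)) + length (map (Product.map suc suc) (pairs k))
    ≡⟨ cong₂ _+_ (trans (length-map _ (allFin k)) (length-tabulate _))
                 (trans (length-map _ (pairs k)) (length-pairs k)) ⟩
  k + k C 2
    ≡⟨ sucC2 k ⟨
  suc k C 2 ∎
  where open ≡-Reasoning

evG : ∀ {m} → Graph m → Fin m × Fin m → Bool
evG h (i , j) = h i j

delete₀ : ∀ {k} → Graph (suc k) → Graph k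
delete₀ h i j = h (suc i) (suc j)

delete₀-simple : ∀ {k} {h : Graph (suc k)} → IsSimple h → IsSimple (delete₀ h)
delete₀-simple (irr , sym′) = (λ i → irr (suc i)) , (λ i j → sym′ (suc i) (suc j))

simple-ext : ∀ m {h h′ : Graph m} → IsSimple h → IsSimple h′ →
             AgreeOn evG (pairs m) h h′ → ∀ i j → h i j ≡ h′ i j
simple-ext (suc k) {h} {h′} sh sh′ agree = onPair
  where
  fromZero = AllP.map⁻ (AllP.++⁻ˡ (map (λ j → zero , suc j) (allFin k)) agree)
  rest     = AllP.map⁻ (AllP.++⁻ʳ (map (λ j → zero , suc j) (allFin k)) agree)
  onZero : ∀ j → h zero (suc j) ≡ h′ zero (suc j)
  onZero j = All.lookup fromZero (∈-allFin j)
  onRest : ∀ i j → h (suc i) (suc j) ≡ h′ (suc i) (suc j)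
  onRest = simple-ext k (delete₀-simple sh) (delete₀-simple sh′) rest
  onPair : ∀ i j → h i j ≡ h′ i j
  onPair zero    zero    = trans (proj₁ sh zero) (sym (proj₁ sh′ zero))
  onPair zero    (suc j) = onZero j
  onPair (suc i) zero    = trans (proj₂ sh (suc i) zero) (trans (onZero i) (proj₂ sh′ zero (suc i)))
  onPair (suc i) (suc j) = onRest i j

switchOut : ∀ {m} → Graph (suc m) → Graph m
switchOut G i j = G (suc i) (suc j) xor (G zero (suc i) xor G zero (suc j))

switchOut-simple : ∀ {m} {G : Graph (suc m)} → IsSimple G → IsSimple (switchOut G)
switchOut-simple {G = G} (irr , sym′) = switchIrr , switchSym
  where
  switchIrr : ∀ i → switchOut G i i ≡ false
  switchIrr i = cong₂ _xor_ (irr (suc i)) (xor-same (G zero (suc i)))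
  switchSym : ∀ i j → switchOut G i j ≡ switchOut G j i
  switchSym i j = cong₂ _xor_ (sym′ (suc i) (suc j)) (xor-comm (G zero (suc i)) (G zero (suc j)))

module Rigidity {m : ℕ} {G H : Graph (suc m)} (sG : IsSimple G) (sH : IsSimple H)
                (sameSwitch : ∀ i j → switchOut G i j ≡ switchOut H i j) where

  SameAt : Fin (suc m) → Set
  SameAt v = G zero v ≡ H zero v

  sameAt-zero : SameAt zero
  sameAt-zero = trans (proj₁ sG zero) (sym (proj₁ sH zero))

  sameAt-step : ∀ v w → SameAt v → G v w ≡ true → H v w ≡ true → SameAt w
  sameAt-step zero    zero    same _  _  = same
  sameAt-step zero    (suc j) _    gE hE = trans gE (sym hE)
  sameAt-step (suc i) zero    _    _  _  = sameAt-zero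
  sameAt-step (suc i) (suc j) same gE hE = xor-solve₃ (trans gE (sym hE)) same (sameSwitch i j)

  sameAt-reach : ∀ {v} → Reach (G ∩ H) zero v → SameAt v
  sameAt-reach here = sameAt-zero
  sameAt-reach (step {v} {w} r e) =
    sameAt-step v w (sameAt-reach r) (∧-conicalˡ (G v w) (H v w) e) (∧-conicalʳ (G v w) (H v w) e)

  equal : Connected (G ∩ H) → ∀ i j → G i j ≡ H i j
  equal c zero    j       = sameAt-reach (c zero j)
  equal c (suc i) zero    =
    trans (proj₂ sG (suc i) zero) (trans (sameAt-reach (c zero (suc i))) (proj₂ sH zero (suc i)))
  equal c (suc i) (suc j) =
    xor-solve₁ (sameAt-reach (c zero (suc i))) (sameAt-reach (c zero (suc j))) (sameSwitch i j)

switchOut-separates : ∀ {m} {G H : Graph (suc m)} → IsSimple G → IsSimple H →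
  Connected (G ∩ H) → Distinct G H → ¬ AgreeOn evG (pairs m) (switchOut G) (switchOut H)
switchOut-separates {m} sG sH c (i , j , G≢H) agree =
  G≢H (Rigidity.equal sG sH sameSwitch c i j)
  where
  sameSwitch = simple-ext m (switchOut-simple sG) (switchOut-simple sH) agree

upper-bound : ∀ m (F : List (Graph (suc m))) → IsConnIntersectingFamily F →
              length F * 2 ^ m ≤ 2 ^ (suc m C 2)
upper-bound m F (simple , distinct , connected) = begin
  length F * 2 ^ m                 ≡⟨ cong (_* 2 ^ m) (length-map switchOut F) ⟨
  length (map switchOut F) * 2 ^ m ≤⟨ *-monoˡ-≤ (2 ^ m) (separated-bound evG (pairs m) _ switchesSeparated) ⟩
  2 ^ length (pairs m) * 2 ^ m     ≡⟨ cong (λ e → 2 ^ e * 2 ^ m) (length-pairs m) ⟩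
  2 ^ (m C 2) * 2 ^ m              ≡⟨ pow-C2-step m ⟩
  2 ^ (suc m C 2)                  ∎
  where
  open ≤-Reasoning
  switchesSeparated : AllPairs (λ G H → ¬ AgreeOn evG (pairs m) G H) (map switchOut F)
  switchesSeparated = AllPairsP.map⁺ (AllPairs.zipWith
    (λ (((sG , sH) , c) , d) → switchOut-separates sG sH c d)
    (AllPairs.zip (All⇒AllPairs _,_ simple , All²⇒AllPairs connected) , distinct))

Separated : ∀ {k} → Vector Bool k → Vector Bool k → Set
Separated {k} v w = Σ (Fin k) λ i → v i ≢ w i

allVectors : (k : ℕ) → List (Vector Bool k)
allVectors zero    = Vector.[] ∷ []
allVectors (suc k) = cartesianProductWith Vector._∷_ (true ∷ false ∷ []) (allVectors k)

length-allVectors : ∀ k → length (allVectors k) ≡ 2 ^ k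
length-allVectors zero    = refl
length-allVectors (suc k) =
  trans (length-product Vector._∷_ (true ∷ false ∷ []) (allVectors k)) (cong (2 *_) (length-allVectors k))

allVectors-separated : ∀ k → AllPairs Separated (allVectors k)
allVectors-separated zero    = [] ∷ []
allVectors-separated (suc k) =
  AllPairs-product Vector._∷_ (λ b≢b′ → zero , b≢b′) (λ (i , ne) → suc i , ne)
    (((λ ()) ∷ []) ∷ [] ∷ []) (allVectors-separated k)

extend : ∀ {k} → Vector Bool k → Graph k → Graph (suc k)
extend v h zero    zero    = false
extend v h zero    (suc j) = v j
extend v h (suc i) zero    = v i
extend v h (suc i) (suc j) = h i j

extend-simple : ∀ {k} {v} {h : Graph k} → IsSimple h → IsSimple (extend v h)
extend-simple {v = v} {h} (irr , sym′) = extIrr , extSym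
  where
  extIrr : ∀ i → extend v h i i ≡ false
  extIrr zero    = refl
  extIrr (suc i) = irr i
  extSym : ∀ i j → extend v h i j ≡ extend v h j i
  extSym zero    zero    = refl
  extSym zero    (suc j) = refl
  extSym (suc i) zero    = refl
  extSym (suc i) (suc j) = sym′ i j

extend-distinctʳ : ∀ {k} {v} {h h′ : Graph k} → Distinct h h′ → Distinct (extend v h) (extend v h′)
extend-distinctʳ (i , j , ne) = suc i , suc j , ne

allSimple : (k : ℕ) → List (Graph k)
allSimple zero    = (λ ()) ∷ []
allSimple (suc k) = cartesianProductWith extend (allVectors k) (allSimple k)

allSimple-simple : ∀ k → All IsSimple (allSimple k)
allSimple-simple zero    = ((λ ()) , (λ ())) ∷ []
allSimple-simple (suc k) = All-product extend extend-simple (allVectors k) (allSimple-simple k)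

allSimple-distinct : ∀ k → AllPairs Distinct (allSimple k)
allSimple-distinct zero    = [] ∷ []
allSimple-distinct (suc k) =
  AllPairs-product extend (λ (i , ne) → zero , suc i , ne) extend-distinctʳ
    (allVectors-separated k) (allSimple-distinct k)

length-allSimple : ∀ k → length (allSimple k) ≡ 2 ^ (k C 2)
length-allSimple zero    = refl
length-allSimple (suc k) = begin
  length (allSimple (suc k))                 ≡⟨ length-product extend (allVectors k) (allSimple k) ⟩
  length (allVectors k) * length (allSimple k) ≡⟨ cong₂ _*_ (length-allVectors k) (length-allSimple k) ⟩
  2 ^ k * 2 ^ (k C 2)                        ≡⟨ *-comm (2 ^ k) (2 ^ (k C 2)) ⟩
  2 ^ (k C 2) * 2 ^ k                        ≡⟨ pow-C2-step k ⟩
  2 ^ (suc k C 2)                            ∎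
  where open ≡-Reasoning

addStar : ∀ {m} → Graph m → Graph (suc m)
addStar = extend (λ _ → true)

star-connected : ∀ {m} (h h′ : Graph m) → Connected (addStar h ∩ addStar h′)
star-connected h h′ u v = fromZero v (toZero u)
  where
  toZero : ∀ u → Reach (addStar h ∩ addStar h′) u zero
  toZero zero    = here
  toZero (suc i) = step here refl
  fromZero : ∀ {u} v → Reach (addStar h ∩ addStar h′) u zero → Reach (addStar h ∩ addStar h′) u v
  fromZero zero    r = r
  fromZero (suc j) r = step r refl

starFamily : ∀ m → List (Graph (suc m))
starFamily m = map addStar (allSimple m)

starFamily-intersecting : ∀ m → IsConnIntersectingFamily (starFamily m)
starFamily-intersecting m =
    AllP.map⁺ (All.map extend-simple (allSimple-simple m))
  , AllPairsP.map⁺ (AllPairs.map extend-distinctʳ (allSimple-distinct m))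
  , AllP.map⁺ (All.universal (λ h → AllP.map⁺ (All.universal (star-connected h) (allSimple m))) (allSimple m))

length-starFamily : ∀ m → length (starFamily m) * 2 ^ m ≡ 2 ^ (suc m C 2)
length-starFamily m = begin
  length (starFamily m) * 2 ^ m ≡⟨ cong (_* 2 ^ m) (trans (length-map addStar (allSimple m)) (length-allSimple m)) ⟩
  2 ^ (m C 2) * 2 ^ m           ≡⟨ pow-C2-step m ⟩
  2 ^ (suc m C 2)               ∎
  where open ≡-Reasoning

theorem2 : (n : ℕ) → 1 ≤ n →
    ((F : List (Graph n)) → IsConnIntersectingFamily F →
      length F * 2 ^ (n ∸ 1) ≤ 2 ^ (n C 2))
    × Σ (List (Graph n)) (λ F → IsConnIntersectingFamily F ×
        length F * 2 ^ (n ∸ 1) ≡ 2 ^ (n C 2))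
theorem2 (suc m) _ =
  upper-bound m , starFamily m , starFamily-intersecting m , length-starFamily m
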